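{- For any (compositional) model $\mathbb{M}=(\mathbb{F},V)$ and any nonempty finite sequence $s=i_1\cdots i_n$ of agents, with $\Box_s:=\Box_{i_1}\cdots\Box_{i_n}$: $\mathbb{M}, a \Vdash \Box_s\phi$ iff for all $x\in X$, if $\mathbb{M}, x \succ \phi$, then $a R_s x$; $\mathbb{M}, x \succ \Box_s\phi$ iff for all $a\in A$, if $\mathbb{M}, a \Vdash \Box_s\phi$, then $a I x$.
   Context: For $S\subseteq A\times X$ let $S^{\uparrow}[B]=\{x\mid \forall a\in B,\ aSx\}$, $S^{\downarrow}[Y]=\{a\mid \forall x\in Y,\ aSx\}$, $I^\uparrow$, $I^\downarrow$ likewise, $x^{\downarrow\uparrow}=I^\uparrow[I^\downarrow[\{x\}]]$. $\mathbb{F}=((A,X,I),\{R_i\}_{i\in\mathsf{Ag}})$ with each $R_i$ $I$-compatible ($R_i^\downarrow[\{x\}]$ and $R_i^\uparrow[\{a\}]$ Galois-stable, i.e. fixed by the closure $I^\downarrow I^\uparrow$ resp. $I^\uparrow I^\downarrow$). $R_s$ is defined recursively: $R_s=R_i$ if $s=i$, and $R_{it}^\downarrow[x]=R_i^\downarrow[I^\uparrow[R_t^\downarrow[x^{\downarrow\uparrow}]]]$. $V$ assigns each atom a formal concept $([\![p]\!],(\![p]\!))$ (extension and description), extended by $[\![\phi\wedge\psi]\!]=[\![\phi]\!]\cap[\![\psi]\!]$, $(\![\phi\vee\psi]\!)=(\![\phi]\!)\cap(\![\psi]\!)$, $[\![\top]\!]=A$, $(\![\bot]\!)=X$, $[\![\Box_i\phi]\!]=R_i^\downarrow[(\![\phi]\!)]$,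 descriptions being $I^\uparrow$ of extensions. $\mathbb{M},a\Vdash\phi$ iff $a\in[\![\phi]\!]$; $\mathbb{M},x\succ\phi$ iff $x\in(\![\phi]\!)$. -}

module Defs where

open import Level using (0ℓ)
open import Data.Product using (_×_; _,_)
open import Data.List using (List; []; _∷_)
open import Relation.Unary using (Pred; _∈_; _∩_)
open import Function.Bundles using (_⇔_)

record Polarity : Set₁ where
  field
    A : Set
    X : Set
    I : A → X → Set

module PolarityOps (P : Polarity) where
  open Polarity P

  _↑[_] : (A → X → Set) → Pred A 0ℓ → Pred X 0ℓ
  S ↑[ B ] = λ x → ∀ a → a ∈ B → S a x

  _↓[_] : (A → X → Set) → Pred X 0ℓ → Pred A 0ℓ
  S ↓[ Y ] = λ a → ∀ x → x ∈ Y → S a x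

  I↑ : Pred A 0ℓ → Pred X 0ℓ
  I↑ B = I ↑[ B ]

  I↓ : Pred X 0ℓ → Pred A 0ℓ
  I↓ Y = I ↓[ Y ]

  _↓↑ : X → Pred X 0ℓ
  x ↓↑ = I↑ (I↓ (λ y → y ≡' x))
    where
      open import Relation.Binary.PropositionalEquality renaming (_≡_ to _≡'_)

  GaloisStableA : Pred A 0ℓ → Set
  GaloisStableA B = ∀ a → (a ∈ I↓ (I↑ B)) ⇔ (a ∈ B)

  GaloisStableX : Pred X 0ℓ → Set
  GaloisStableX Y = ∀ x → (x ∈ I↑ (I↓ Y)) ⇔ (x ∈ Y)

  IsICompatible : (A → X → Set) → Set
  IsICompatible R =
    (∀ x → GaloisStableA (R ↓[ (λ y → y ≡' x) ])) ×
    (∀ a → GaloisStableX (R ↑[ (λ b → b ≡' a) ]))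
    where
      open import Relation.Binary.PropositionalEquality renaming (_≡_ to _≡'_)

record Frame (Ag : Set) : Set₁ where
  field
    polarity : Polarity
  open Polarity polarity public
  open PolarityOps polarity public
  field
    R : Ag → A → X → Set
    R-compatible : ∀ i → IsICompatible (R i)

  -- R_s for a nonempty sequence s = i ∷ t (given as head i and tail t):
  -- R_i if t = [], and R_{i t}↓[x] = R_i↓[I↑[R_t↓[x↓↑]]]
  Rseq : Ag → List Ag → A → X → Set
  Rseq i [] = R i
  Rseq i (j ∷ t) a x = a ∈ (R i ↓[ I↑ ((Rseq j t) ↓[ x ↓↑ ]) ])

data Fm (Ag : Set) (Prop : Set) : Set where
  atom : Prop → Fm Ag Prop
  ⊤f ⊥f : Fm Ag Prop
  _∧f_ _∨f_ : Fm Ag Prop → Fm Ag Prop → Fm Ag Prop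
  □ : Ag → Fm Ag Prop → Fm Ag Prop

□seq : {Ag Prop : Set} → Ag → List Ag → Fm Ag Prop → Fm Ag Prop
□seq i [] φ = □ i φ
□seq i (j ∷ t) φ = □ i (□seq j t φ)

-- Model M = (F, V): V maps each atom to a formal concept ([[p]], (p))
record Model (Ag Prop : Set) : Set₁ where
  field
    frame : Frame Ag
  open Frame frame public
  field
    Vext : Prop → Pred A 0ℓ
    Vdesc : Prop → Pred X 0ℓ
    V-concept₁ : ∀ p a → (a ∈ Vext p) ⇔ (a ∈ I↓ (Vdesc p))
    V-concept₂ : ∀ p x → (x ∈ Vdesc p) ⇔ (x ∈ I↑ (Vext p))

  ext  : Fm Ag Prop → Pred A 0ℓ
  desc : Fm Ag Prop → Pred X 0ℓ

  ext (atom p) = Vext p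
  ext ⊤f = λ _ → Data.Unit.⊤ where import Data.Unit
  ext ⊥f = I↓ (λ _ → Data.Unit.⊤) where import Data.Unit
  ext (φ ∧f ψ) = ext φ ∩ ext ψ
  ext (φ ∨f ψ) = I↓ (desc φ ∩ desc ψ)
  ext (□ i φ) = R i ↓[ desc φ ]

  desc (atom p) = Vdesc p
  desc ⊥f = λ _ → Data.Unit.⊤ where import Data.Unit
  desc (φ ∨f ψ) = desc φ ∩ desc ψ
  desc ⊤f = I↑ (ext ⊤f)
  desc (φ ∧f ψ) = I↑ (ext (φ ∧f ψ))
  desc (□ i φ) = I↑ (ext (□ i φ))

  _⊩_ : A → Fm Ag Prop → Set
  a ⊩ φ = a ∈ ext φ

  _≻_ : X → Fm Ag Prop → Set
  x ≻ φ = x ∈ desc φ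

module Submission where

-- Write  R ⨾ S  for the relation  a (R ⨾ S) x  ⟺  a ∈ R↓[I↑[S↓[x↓↑]]],
-- so that  R_{it} = R_i ⨾ R_t.  Call S ⊆ A × X *coherent* when every S↓[{x}] is
-- Galois-closed and every S↑[{b}] is closed under x ↦ x↓↑.  Then:
--   * every I-compatible relation is coherent, and so is  R ⨾ S  whenever R is
--     I-compatible; hence every R_s is coherent (no induction needed);
--   * for R I-compatible and S coherent, for every Y ⊆ X
--         R↓[I↑[S↓[Y]]]  =  ⋂_{x ∈ Y} (R ⨾ S)↓[{x}]            (box-⨾)
--     i.e. the intersection over x ∈ Y commutes with R↓[I↑[ - ]].
-- The first clause of the theorem follows by induction on s: [[□_i □_t φ]] is
-- R_i↓[I↑[[□_t φ]]], the induction hypothesis rewrites [[□_t φ]] as R_t↓[(φ)],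
-- and box-⨾ with Y = (φ) gives ⋂_{x ∈ (φ)} R_{it}↓[{x}].  The second clause is
-- the definition of descriptions of boxed formulas.

open import Defs
open import Level using (0ℓ)
open import Data.Product using (_×_; _,_)
open import Data.List using (List; []; _∷_)
open import Function.Bundles using (_⇔_; mk⇔; Equivalence)
open import Function.Properties.Equivalence using ()
  renaming (refl to ⇔-refl; trans to ⇔-trans)
open import Relation.Binary.PropositionalEquality using (_≡_; subst)
  renaming (refl to ≡-refl; sym to ≡-sym)
open import Relation.Unary using (Pred; _∈_; _⊆_)

module GaloisFacts (P : Polarity) where
  open Polarity P
  open PolarityOps P

  Rel : Set₁
  Rel = A → X → Set

  single : {C : Set} → C → Pred C 0ℓ
  single x = λ y → y ≡ x

  ↓-single : (S : Rel) {b : A} {x : X} → S b x → b ∈ S ↓[ single x ]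
  ↓-single S r y y≡x = subst (S _) (≡-sym y≡x) r

  ↓-single⁻ : (S : Rel) {b : A} {x : X} → b ∈ S ↓[ single x ] → S b x
  ↓-single⁻ S {x = x} b∈ = b∈ x ≡-refl

  ↑-single : (S : Rel) {b : A} {x : X} → S b x → x ∈ S ↑[ single b ]
  ↑-single S r c c≡b = subst (λ c → S c _) (≡-sym c≡b) r

  ↑-antitone : (S : Rel) {B B′ : Pred A 0ℓ} → B ⊆ B′ → S ↑[ B′ ] ⊆ S ↑[ B ]
  ↑-antitone S B⊆B′ x∈ a a∈B = x∈ a (B⊆B′ a∈B)

  ↓-antitone : (S : Rel) {Y Y′ : Pred X 0ℓ} → Y ⊆ Y′ → S ↓[ Y′ ] ⊆ S ↓[ Y ]
  ↓-antitone S Y⊆Y′ a∈ x x∈Y = a∈ x (Y⊆Y′ x∈Y)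

  ↓I↑-monotone : (R : Rel) {B B′ : Pred A 0ℓ} → B ⊆ B′ → R ↓[ I↑ B ] ⊆ R ↓[ I↑ B′ ]
  ↓I↑-monotone R B⊆B′ = ↓-antitone R (↑-antitone I B⊆B′)

  ↓↑-refl : (x : X) → x ∈ x ↓↑
  ↓↑-refl x c c∈ = c∈ x ≡-refl

  single⊆↓↑ : (x : X) → single x ⊆ x ↓↑
  single⊆↓↑ x y≡x = subst _ (≡-sym y≡x) (↓↑-refl x)

  ↓↑-least : {Y : Pred X 0ℓ} → GaloisStableX Y → {x : X} → x ∈ Y → x ↓↑ ⊆ Y
  ↓↑-least stable x∈Y {z} z∈x↓↑ =
    Equivalence.to (stable z) λ c c∈I↓Y → z∈x↓↑ c (↓-single I (c∈I↓Y _ x∈Y))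

  ↓↑-trans : {x z : X} → z ∈ x ↓↑ → z ↓↑ ⊆ x ↓↑
  ↓↑-trans z∈x↓↑ z′∈z↓↑ c c∈ = z′∈z↓↑ c (↓-single I (z∈x↓↑ c c∈))

  -- If every R↓[{x}] is Galois-closed, so is every R↓[Y] (an intersection of them).
  ↓-closed : (R : Rel) → (∀ x → GaloisStableA (R ↓[ single x ])) →
             (Y : Pred X 0ℓ) → I↓ (I↑ (R ↓[ Y ])) ⊆ R ↓[ Y ]
  ↓-closed R stable Y {a} a∈ x x∈Y =
    Equivalence.to (stable x a)
      (λ w w∈ → a∈ w λ b b∈R↓Y → w∈ b λ y y≡x → b∈R↓Y y (subst Y (≡-sym y≡x) x∈Y))
      x ≡-refl

  ↓I↑-intro : (R : Rel) {a : A} → GaloisStableX (R ↑[ single a ]) →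
              {B : Pred A 0ℓ} → I↓ (R ↑[ single a ]) ⊆ B → a ∈ R ↓[ I↑ B ]
  ↓I↑-intro R {a} stable I↓R↑⊆B y y∈I↑B =
    Equivalence.to (stable y) (λ c c∈ → y∈I↑B c (I↓R↑⊆B c∈)) a ≡-refl

  -- Coherent relations: the two closure properties shared by all R_s.
  record Coherent (S : Rel) : Set where
    field
      closedA : ∀ {b x} → b ∈ I↓ (I↑ (S ↓[ single x ])) → S b x
      closedX : ∀ {b x z} → S b x → z ∈ x ↓↑ → S b z

  _⨾_ : Rel → Rel → Rel
  (R ⨾ S) a x = a ∈ R ↓[ I↑ (S ↓[ x ↓↑ ]) ]

  compatible⇒coherent : (R : Rel) → IsICompatible R → Coherent R
  compatible⇒coherent R (stableA , stableX) = record
    { closedA = λ {b} {x} b∈ → Equivalence.to (stableA x b) b∈ x ≡-refl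
    ; closedX = λ {b} r z∈x↓↑ → ↓↑-least (stableX b) (↑-single R r) z∈x↓↑ b ≡-refl
    }

  ⨾-coherent : (R S : Rel) → IsICompatible R → Coherent (R ⨾ S)
  ⨾-coherent R S (stableA , _) = record
    { closedA = λ b∈ →
        ↓-closed R stableA _
          (↓-antitone I (↑-antitone I (↓-single⁻ (R ⨾ S))) b∈)
    ; closedX = λ r z∈x↓↑ →
        ↓I↑-monotone R (↓-antitone S (↓↑-trans z∈x↓↑)) r
    }

  box-⨾ : (R S : Rel) → IsICompatible R → Coherent S → (Y : Pred X 0ℓ) (a : A) →
          a ∈ R ↓[ I↑ (S ↓[ Y ]) ] ⇔ (∀ x → x ∈ Y → (R ⨾ S) a x)
  box-⨾ R S (_ , stableX) coh Y a = mk⇔ toAll fromAll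
    where
      open Coherent coh

      -- S↓[Y] ⊆ S↓[x↓↑] for x ∈ Y, because S↑[{b}] is closed under ↓↑.
      toAll : a ∈ R ↓[ I↑ (S ↓[ Y ]) ] → ∀ x → x ∈ Y → (R ⨾ S) a x
      toAll a∈ x x∈Y = ↓I↑-monotone R (λ b∈ z z∈x↓↑ → closedX (b∈ x x∈Y) z∈x↓↑) a∈

      -- Conversely each S↓[{x}] is closed, so it is enough to test c against
      -- I↑[S↓[{x}]] ⊆ I↑[S↓[x↓↑]], where a is R-related to everything.
      fromAll : (∀ x → x ∈ Y → (R ⨾ S) a x) → a ∈ R ↓[ I↑ (S ↓[ Y ]) ]
      fromAll H = ↓I↑-intro R (stableX a) λ c∈ x x∈Y →
        closedA λ w w∈ →
          c∈ w (↑-single R (H x x∈Y w (↑-antitone I (↓-antitone S (single⊆↓↑ x)) w∈)))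

module BoxSequences {Ag Prop : Set} (M : Model Ag Prop) where
  open Model M
  open GaloisFacts polarity

  Rseq-coherent : (i : Ag) (t : List Ag) → Coherent (Rseq i t)
  Rseq-coherent i []      = compatible⇒coherent (R i) (R-compatible i)
  Rseq-coherent i (j ∷ t) = ⨾-coherent (R i) (Rseq j t) (R-compatible i)

  desc-□seq : (i : Ag) (t : List Ag) (φ : Fm Ag Prop) →
              desc (□seq i t φ) ≡ I↑ (ext (□seq i t φ))
  desc-□seq i []      φ = ≡-refl
  desc-□seq i (j ∷ t) φ = ≡-refl

  ext-□seq : (i : Ag) (t : List Ag) (φ : Fm Ag Prop) (a : A) →
             (a ⊩ □seq i t φ) ⇔ (∀ x → x ≻ φ → Rseq i t a x)
  ext-□seq i []      φ a = ⇔-refl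
  ext-□seq i (j ∷ t) φ a rewrite desc-□seq j t φ =
    ⇔-trans
      (mk⇔ (↓I↑-monotone (R i) (Equivalence.to (ext-□seq j t φ _)))
           (↓I↑-monotone (R i) (Equivalence.from (ext-□seq j t φ _))))
      (box-⨾ (R i) (Rseq j t) (R-compatible i) (Rseq-coherent j t) (desc φ) a)

  desc-□seq-⇔ : (i : Ag) (t : List Ag) (φ : Fm Ag Prop) (x : X) →
                (x ≻ □seq i t φ) ⇔ (∀ a → a ⊩ □seq i t φ → I a x)
  desc-□seq-⇔ i t φ x rewrite desc-□seq i t φ = ⇔-refl

lemmaA11 : {Ag Prop : Set} (M : Model Ag Prop) (i : Ag) (t : List Ag) (φ : Fm Ag Prop) →
    let open Model M in
    (∀ a → (a ⊩ □seq i t φ) ⇔ (∀ x → x ≻ φ → Rseq i t a x)) ×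
    (∀ x → (x ≻ □seq i t φ) ⇔ (∀ a → a ⊩ □seq i t φ → I a x))
lemmaA11 M i t φ = ext-□seq i t φ , desc-□seq-⇔ i t φ
  where open BoxSequences M
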